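{- For every integer $x\ge 0$, the \textsc{flag coloring} position on the path with $x$ edges (i.e. $x+1$ vertices), properly two-colored, has Sprague–Grundy value $\ast(x \bmod 3)$.
   Context: \textsc{flag coloring} is an impartial two-player game played on a simple graph whose vertices are colored. A move consists of choosing a vertex $v$, of color $c$ say, and a color $c'\neq c$ that is the color of some vertex adjacent to $v$; then $v$ and every vertex of the connected component of the subgraph induced by color-$c$ vertices that contains $v$ are recolored $c'$. Play is under the normal play convention: a player unable to move loses. Each position gets a Sprague–Grundy value (nimber) $\ast n$, where $n$ is the minimum non-negative integer not among the values of its options (positions with no options have value $0$); $\ast 0=0$. -}

module Defs where

open import Data.Nat using (ℕ; zero; suc; _<_; _%_)
open import Data.Fin using (Fin; toℕ)
open import Data.Product using (Σ; _×_; ∃)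
open import Data.Sum using (_⊎_)
open import Relation.Binary.PropositionalEquality using (_≡_; _≢_)
open import Relation.Nullary using (¬_)

record Graph : Set₁ where
  field
    size : ℕ
    Adj  : Fin size → Fin size → Set
open Graph public

Coloring : Graph → Set
Coloring G = Fin (size G) → ℕ

-- SameComp G col c v w : v and w lie in the same connected component of the
-- subgraph induced by the vertices of colour c (in particular both have colour c).
data SameComp (G : Graph) (col : Coloring G) (c : ℕ) : Fin (size G) → Fin (size G) → Set where
  here : ∀ {v} → col v ≡ c → SameComp G col c v v
  step : ∀ {v u w} → col v ≡ c → Adj G v u → SameComp G col c u w → SameComp G col c v w

-- A flag coloring move from col to col': choose a vertex v (colour c = col v)
-- and a colour c' ≠ c that is the colour of some neighbour of v; then the
-- colour-c component containing v is recoloured c', all else unchanged.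
Move : (G : Graph) → Coloring G → Coloring G → Set
Move G col col' =
  Σ (Fin (size G)) λ v → Σ ℕ λ c' →
    (Σ (Fin (size G)) λ u → Adj G v u × col u ≡ c') ×
    (c' ≢ col v) ×
    (∀ w → (SameComp G col (col v) v w → col' w ≡ c') ×
           (¬ SameComp G col (col v) v w → col' w ≡ col w))

-- IsGrundy G col n : the position col has Sprague–Grundy value *n, i.e.
-- n is the mex of the values of its options (inductively, hence also
-- asserting the game tree from col is well founded).
data IsGrundy (G : Graph) : Coloring G → ℕ → Set where
  grundy : ∀ {col n} →
    (∀ col' → Move G col col' → Σ ℕ λ m → IsGrundy G col' m × m ≢ n) →
    (∀ k → k < n → Σ (Coloring G) λ col' → Move G col col' × IsGrundy G col' k) →
    IsGrundy G col n

PathGraph : ℕ → Graph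
PathGraph x = record
  { size = suc x
  ; Adj  = λ i j → (toℕ j ≡ suc (toℕ i)) ⊎ (toℕ i ≡ suc (toℕ j)) }

properTwoColoring : (x : ℕ) → Coloring (PathGraph x)
properTwoColoring x i = toℕ i % 2

{-# OPTIONS --safe #-}
-- Every position reachable from the proper two-colouring of a path is again two-coloured, so it is a
-- sequence of maximal monochromatic runs, and a move recolours one run into the other colour, merging
-- it with its neighbours. The number of colour changes along the path therefore drops by 1 (end run)
-- or by 2 (inner run), and each drop is available as soon as it is possible: recolour the first or the
-- second run. The game is thus the subtraction game {1, 2} played on the number of colour changes, whose
-- Grundy value is that number mod 3; the proper colouring of the path with x edges has x changes.
module Submission where

open import Defs
open import Data.Nat.Properties
open import Algebra.Properties.CommutativeSemigroup +-commutativeSemigroup using (interchange)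
open import Data.Bool using (if_then_else_)
open import Data.Empty using (⊥-elim)
open import Data.Fin using (Fin; toℕ; fromℕ<)
open import Data.Fin.Properties using (toℕ<n; toℕ-fromℕ<; fromℕ<-toℕ)
open import Data.Nat using (ℕ; zero; suc; _+_; _*_; _∸_; _≤_; _<_; z≤n; s≤s; _%_; _≤?_; _≟_)
open import Data.Nat.DivMod using ([m+n]%n≡m%n; m%n<n)
open import Data.Nat.Induction using (<-wellFounded)
open import Data.Product using (∃-syntax; _×_; _,_; proj₁; proj₂)
open import Data.Sum using (_⊎_; inj₁; inj₂)
import Data.Sum as Sum
open import Function using (_∘′_)
open import Induction.WellFounded using (Acc; acc)
open import Relation.Binary.Definitions using (tri<; tri≈; tri>)
open import Relation.Binary.PropositionalEquality
open import Relation.Nullary using (¬_; Dec; yes; no; does)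
open import Relation.Nullary.Decidable using (dec-true; dec-false; _×-dec_)

%3-periodic : ∀ n → (3 + n) % 3 ≡ n % 3
%3-periodic n = trans (cong (_% 3) (+-comm 3 n)) ([m+n]%n≡m%n n 3)

[1+n]%3≢n%3 : ∀ n → (1 + n) % 3 ≢ n % 3
[1+n]%3≢n%3 0 ()
[1+n]%3≢n%3 1 ()
[1+n]%3≢n%3 2 ()
[1+n]%3≢n%3 (suc (suc (suc n))) eq =
  [1+n]%3≢n%3 n (trans (sym (%3-periodic (1 + n))) (trans eq (%3-periodic n)))

[2+n]%3≢n%3 : ∀ n → (2 + n) % 3 ≢ n % 3
[2+n]%3≢n%3 0 ()
[2+n]%3≢n%3 1 ()
[2+n]%3≢n%3 2 ()
[2+n]%3≢n%3 (suc (suc (suc n))) eq =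
  [2+n]%3≢n%3 n (trans (sym (%3-periodic (2 + n))) (trans eq (%3-periodic n)))

<%3⇒reachable : ∀ n {k} → k < n % 3 →
  (∃[ m ] n ≡ 1 + m × m % 3 ≡ k) ⊎ (∃[ m ] n ≡ 2 + m × m % 3 ≡ k)
<%3⇒reachable 0 ()
<%3⇒reachable 1 {0}           _                = inj₁ (0 , refl , refl)
<%3⇒reachable 1 {suc k}       (s≤s ())
<%3⇒reachable 2 {0}           _                = inj₂ (0 , refl , refl)
<%3⇒reachable 2 {1}           _                = inj₁ (1 , refl , refl)
<%3⇒reachable 2 {suc (suc k)} (s≤s (s≤s ()))
<%3⇒reachable (suc (suc (suc n))) {k} lt with <%3⇒reachable n (subst (k <_) (%3-periodic n) lt)
... | inj₁ (m , refl , m%3) = inj₁ (3 + m , refl , trans (%3-periodic m) m%3)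
... | inj₂ (m , refl , m%3) = inj₂ (3 + m , refl , trans (%3-periodic m) m%3)

%2-periodic : ∀ n → (2 + n) % 2 ≡ n % 2
%2-periodic n = trans (cong (_% 2) (+-comm 2 n)) ([m+n]%n≡m%n n 2)

n%2≢[1+n]%2 : ∀ n → n % 2 ≢ (1 + n) % 2
n%2≢[1+n]%2 0 ()
n%2≢[1+n]%2 1 ()
n%2≢[1+n]%2 (suc (suc n)) eq =
  n%2≢[1+n]%2 n (trans (sym (%2-periodic n)) (trans eq (%2-periodic (1 + n))))

≤1-flip : ∀ {p r} → p ≤ 1 → r ≤ 1 → p ≢ r → p ≡ 1 ∸ r
≤1-flip z≤n       z≤n       p≢r = ⊥-elim (p≢r refl)
≤1-flip z≤n       (s≤s z≤n) p≢r = refl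
≤1-flip (s≤s z≤n) z≤n       p≢r = refl
≤1-flip (s≤s z≤n) (s≤s z≤n) p≢r = ⊥-elim (p≢r refl)

-- The subtraction game {1, 2}

module _ {G : Graph} (Legal : Coloring G → Set) (d : Coloring G → ℕ)
  (legal-move  : ∀ {col col′} → Legal col → Move G col col′ → Legal col′)
  (move-lowers : ∀ {col col′} → Legal col → Move G col col′ →
                 d col ≡ 1 + d col′ ⊎ d col ≡ 2 + d col′)
  (lower-by-1  : ∀ {col m} → Legal col → d col ≡ 1 + m → ∃[ col′ ] Move G col col′ × d col′ ≡ m)
  (lower-by-2  : ∀ {col m} → Legal col → d col ≡ 2 + m → ∃[ col′ ] Move G col col′ × d col′ ≡ m)
  where

  isGrundy-%3 : ∀ col → Legal col → IsGrundy G col (d col % 3)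
  isGrundy-%3 col legal = go col legal (<-wellFounded (d col))
    where
    go : ∀ col → Legal col → Acc _<_ (d col) → IsGrundy G col (d col % 3)
    go col legal (acc below) = grundy options lower
      where
      drop₁ : ∀ {n} → d col ≡ 1 + n → n < d col
      drop₁ eq = ≤-reflexive (sym eq)

      drop₂ : ∀ {n} → d col ≡ 2 + n → n < d col
      drop₂ eq = <⇒≤ (≤-reflexive (sym eq))

      descend : ∀ {col′} → Move G col col′ → d col′ < d col → IsGrundy G col′ (d col′ % 3)
      descend mv lt = go _ (legal-move legal mv) (below lt)

      options : ∀ col′ → Move G col col′ → ∃[ m ] IsGrundy G col′ m × m ≢ d col % 3
      options col′ mv with move-lowers legal mv
      ... | inj₁ eq = _ , descend mv (drop₁ eq) ,
                      λ e → [1+n]%3≢n%3 (d col′) (trans (cong (_% 3) (sym eq)) (sym e))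
      ... | inj₂ eq = _ , descend mv (drop₂ eq) ,
                      λ e → [2+n]%3≢n%3 (d col′) (trans (cong (_% 3) (sym eq)) (sym e))

      lower : ∀ k → k < d col % 3 → ∃[ col′ ] Move G col col′ × IsGrundy G col′ k
      lower k lt with <%3⇒reachable (d col) lt
      ... | inj₁ (m , eq , m%3) with lower-by-1 legal eq
      ...   | col′ , mv , refl = col′ , mv , subst (IsGrundy G col′) m%3 (descend mv (drop₁ eq))
      lower k lt | inj₂ (m , eq , m%3) with lower-by-2 legal eq
      ...   | col′ , mv , refl = col′ , mv , subst (IsGrundy G col′) m%3 (descend mv (drop₂ eq))

-- Colour changes along a sequence

sumBelow : ℕ → (ℕ → ℕ) → ℕ
sumBelow zero    h = 0
sumBelow (suc n) h = sumBelow n h + h n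

sumBelow-cong : ∀ n {h h′ : ℕ → ℕ} → (∀ {i} → i < n → h i ≡ h′ i) →
  sumBelow n h ≡ sumBelow n h′
sumBelow-cong zero    eq = refl
sumBelow-cong (suc n) eq = cong₂ _+_ (sumBelow-cong n (eq ∘′ m<n⇒m<1+n)) (eq (n<1+n n))

sumBelow-+ : ∀ n (h h′ : ℕ → ℕ) → sumBelow n (λ i → h i + h′ i) ≡ sumBelow n h + sumBelow n h′
sumBelow-+ zero    h h′ = refl
sumBelow-+ (suc n) h h′ = trans (cong (_+ (h n + h′ n)) (sumBelow-+ n h h′))
                                (interchange (sumBelow n h) (sumBelow n h′) (h n) (h′ n))

sumBelow-const : ∀ n k → sumBelow n (λ _ → k) ≡ n * k
sumBelow-const zero    k = refl
sumBelow-const (suc n) k = trans (cong (_+ k) (sumBelow-const n k)) (+-comm (n * k) k)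

δ : ℕ → ℕ → ℕ
δ m n = if does (m ≟ n) then 1 else 0

differ : ℕ → ℕ → ℕ
differ m n = if does (m ≟ n) then 0 else 1

δ-≡ : ∀ {m n} → m ≡ n → δ m n ≡ 1
δ-≡ {m} {n} eq rewrite dec-true (m ≟ n) eq = refl

δ-≢ : ∀ {m n} → m ≢ n → δ m n ≡ 0
δ-≢ {m} {n} neq rewrite dec-false (m ≟ n) neq = refl

differ-≡ : ∀ {m n} → m ≡ n → differ m n ≡ 0
differ-≡ {m} {n} eq rewrite dec-true (m ≟ n) eq = refl

differ-≢ : ∀ {m n} → m ≢ n → differ m n ≡ 1
differ-≢ {m} {n} neq rewrite dec-false (m ≟ n) neq = refl

sumBelow-δ-≥ : ∀ n {b} → n ≤ b → sumBelow n (λ i → δ i b) ≡ 0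
sumBelow-δ-≥ zero    _   = refl
sumBelow-δ-≥ (suc n) n<b = cong₂ _+_ (sumBelow-δ-≥ n (<⇒≤ n<b)) (δ-≢ (<⇒≢ n<b))

sumBelow-δ-< : ∀ n {b} → b < n → sumBelow n (λ i → δ i b) ≡ 1
sumBelow-δ-< (suc n) b<1+n with m<1+n⇒m<n∨m≡n b<1+n
... | inj₁ b<n  = cong₂ _+_ (sumBelow-δ-< n b<n) (δ-≢ (>⇒≢ b<n))
... | inj₂ refl = cong₂ _+_ (sumBelow-δ-≥ n ≤-refl) (δ-≡ {n} refl)

changeAt : (ℕ → ℕ) → ℕ → ℕ
changeAt f i = differ (f i) (f (suc i))

changes : ℕ → (ℕ → ℕ) → ℕ
changes x f = sumBelow x (changeAt f)

changes-constant : ∀ {x c} {f : ℕ → ℕ} → (∀ {j} → j ≤ x → f j ≡ c) → changes x f ≡ 0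
changes-constant {x} {f = f} const = begin
  changes x f           ≡⟨ sumBelow-cong x (differ-≡ ∘′ unchanged) ⟩
  sumBelow x (λ _ → 0)  ≡⟨ sumBelow-const x 0 ⟩
  x * 0                 ≡⟨ *-zeroʳ x ⟩
  0                     ∎
  where
  open ≡-Reasoning
  unchanged : ∀ {i} → i < x → f i ≡ f (suc i)
  unchanged i<x = trans (const (<⇒≤ i<x)) (sym (const i<x))

changes-alternating : ∀ {x} {f : ℕ → ℕ} → (∀ {i} → i < x → f i ≢ f (suc i)) → changes x f ≡ x
changes-alternating {x} {f} alt = begin
  changes x f           ≡⟨ sumBelow-cong x (differ-≢ ∘′ alt) ⟩
  sumBelow x (λ _ → 1)  ≡⟨ sumBelow-const x 1 ⟩
  x * 1                 ≡⟨ *-identityʳ x ⟩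
  x                     ∎
  where open ≡-Reasoning

-- For a ≤ b ≤ x: the number of edges {i, 1 + i} of the path 0 … x with exactly one end in [a, b].
exits : ℕ → ℕ → ℕ → ℕ
exits x a b = sumBelow x (λ i → δ (suc i) a) + sumBelow x (λ i → δ i b)

exits-initial : ∀ {x b} → b < x → exits x 0 b ≡ 1
exits-initial {x} b<x = cong₂ _+_ (trans (sumBelow-const x 0) (*-zeroʳ x)) (sumBelow-δ-< x b<x)

exits-inner : ∀ {x a b} → suc a ≤ b → b < x → exits x (suc a) b ≡ 2
exits-inner {x} a<b b<x = cong₂ _+_ (sumBelow-δ-< x (<-≤-trans a<b (<⇒≤ b<x))) (sumBelow-δ-< x b<x)

exits-final : ∀ {x a} → a < x → exits x (suc a) x ≡ 1
exits-final {x} a<x = cong₂ _+_ (sumBelow-δ-< x a<x) (sumBelow-δ-≥ x ≤-refl)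

exits≡1⊎2 : ∀ {x a b} → a ≤ b → b ≤ x → ¬ (a ≡ 0 × b ≡ x) →
  exits x a b ≡ 1 ⊎ exits x a b ≡ 2
exits≡1⊎2 {a = zero}  a≤b b≤x proper with m≤n⇒m<n∨m≡n b≤x
... | inj₁ b<x  = inj₁ (exits-initial b<x)
... | inj₂ refl = ⊥-elim (proper (refl , refl))
exits≡1⊎2 {a = suc a} a≤b b≤x proper with m≤n⇒m<n∨m≡n b≤x
... | inj₁ b<x  = inj₂ (exits-inner a≤b b<x)
... | inj₂ refl = inj₁ (exits-final a≤b)

-- Maximal runs

infix 4 _∈[_,_]
_∈[_,_] : ℕ → ℕ → ℕ → Set
j ∈[ a , b ] = a ≤ j × j ≤ b

ConstantOn : (ℕ → ℕ) → ℕ → ℕ → ℕ → Set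
ConstantOn f c a b = ∀ {j} → j ∈[ a , b ] → f j ≡ c

constantOn-point : ∀ {f : ℕ → ℕ} {c v} → f v ≡ c → ConstantOn f c v v
constantOn-point {f} eq (v≤j , j≤v) = subst (λ k → f k ≡ _) (≤-antisym v≤j j≤v) eq

constantOn-extendʳ : ∀ {f : ℕ → ℕ} {c a b} → ConstantOn f c a b → f (suc b) ≡ c →
  ConstantOn f c a (suc b)
constantOn-extendʳ const eq (a≤j , j≤1+b) with m≤n⇒m<n∨m≡n j≤1+b
... | inj₁ j<1+b = const (a≤j , ≤-pred j<1+b)
... | inj₂ refl  = eq

constantOn-join : ∀ {f : ℕ → ℕ} {c a v b} → ConstantOn f c a v → ConstantOn f c v b →
  ConstantOn f c a b
constantOn-join {v = v} left right {j} (a≤j , j≤b) with ≤-total j v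
... | inj₁ j≤v = left (a≤j , j≤v)
... | inj₂ v≤j = right (v≤j , j≤b)

changes-twoRuns : ∀ {x a b₀ c₀ c₁} {f : ℕ → ℕ} → ConstantOn f c₀ 0 b₀ → ConstantOn f c₁ a x →
  a ≤ suc b₀ → b₀ < x → c₀ ≢ c₁ → changes x f ≡ 1
changes-twoRuns {x} {a} {b₀} {f = f} first second a≤1+b₀ b₀<x c₀≢c₁ =
  trans (sumBelow-cong x changeAt≡δ) (sumBelow-δ-< x b₀<x)
  where
  changeAt≡δ : ∀ {i} → i < x → changeAt f i ≡ δ i b₀
  changeAt≡δ {i} i<x with <-cmp i b₀
  ... | tri< i<b₀ _ _ =
    trans (differ-≡ (trans (first (z≤n , <⇒≤ i<b₀)) (sym (first (z≤n , i<b₀)))))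
          (sym (δ-≢ (<⇒≢ i<b₀)))
  ... | tri≈ _ refl _ =
    trans (differ-≢ λ e → c₀≢c₁ (trans (sym (first (z≤n , ≤-refl)))
                                      (trans e (second (a≤1+b₀ , i<x)))))
          (sym (δ-≡ {i} refl))
  ... | tri> _ _ b₀<i =
    trans (differ-≡ (trans (second (≤-trans a≤1+b₀ b₀<i , <⇒≤ i<x))
                           (sym (second (≤-trans a≤1+b₀ (m<n⇒m<1+n b₀<i) , i<x)))))
          (sym (δ-≢ (>⇒≢ b₀<i)))

record MaximalRun (x : ℕ) (f : ℕ → ℕ) (c a b : ℕ) : Set where
  field
    a≤b          : a ≤ b
    b≤x          : b ≤ x
    constant     : ConstantOn f c a b
    leftMaximal  : ∀ {j} → suc j ≡ a → f j ≢ c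
    rightMaximal : b < x → f (suc b) ≢ c

runStart : ∀ (f : ℕ → ℕ) {c} v → f v ≡ c →
  ∃[ a ] a ≤ v × ConstantOn f c a v × (∀ {j} → suc j ≡ a → f j ≢ c)
runStart f zero eq = 0 , z≤n , constantOn-point {f} eq , λ ()
runStart f {c} (suc v) eq with f v ≟ c
... | no  fv≢c = suc v , ≤-refl , constantOn-point {f} eq , λ { refl → fv≢c }
... | yes fv≡c with runStart f v fv≡c
...   | a , a≤v , const , leftMax = a , m≤n⇒m≤1+n a≤v , constantOn-extendʳ const eq , leftMax

runEnd : ∀ (f : ℕ → ℕ) {c v} x → v ≤ x → f v ≡ c →
  ∃[ b ] v ≤ b × b ≤ x × ConstantOn f c v b × (b < x → f (suc b) ≢ c)
runEnd f {c} {v} x v≤x eq with m≤n⇒m<n∨m≡n v≤x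
runEnd f {c} {v} x v≤x eq | inj₂ refl =
  v , ≤-refl , ≤-refl , constantOn-point {f} eq , ⊥-elim ∘′ <-irrefl refl
runEnd f {c} {v} (suc x) v≤x eq | inj₁ v<1+x with runEnd f x (≤-pred v<1+x) eq
... | b , v≤b , b≤x , const , rightMax with m≤n⇒m<n∨m≡n b≤x
...   | inj₁ b<x  = b , v≤b , m≤n⇒m≤1+n b≤x , const , λ _ → rightMax b<x
...   | inj₂ refl with f (suc b) ≟ c
...     | no  f[1+b]≢c = b , v≤b , n≤1+n b , const , λ _ → f[1+b]≢c
...     | yes f[1+b]≡c =
  suc b , m≤n⇒m≤1+n v≤b , ≤-refl , constantOn-extendʳ const f[1+b]≡c , ⊥-elim ∘′ <-irrefl refl

maximalRun : ∀ {x} (f : ℕ → ℕ) {c v} → v ≤ x → f v ≡ c →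
  ∃[ a ] ∃[ b ] v ∈[ a , b ] × MaximalRun x f c a b
maximalRun {x} f {v = v} v≤x eq with runStart f v eq | runEnd f x v≤x eq
... | a , a≤v , left , leftMax | b , v≤b , b≤x , right , rightMax =
  a , b , (a≤v , v≤b) , record
    { a≤b = ≤-trans a≤v v≤b ; b≤x = b≤x ; constant = constantOn-join left right
    ; leftMaximal = leftMax ; rightMaximal = rightMax }

module _ {x f c a b} (run : MaximalRun x f c a b) where
  open MaximalRun run

  maximalRun-stepʳ : ∀ {i} → suc i ≤ x → f (suc i) ≡ c → i ∈[ a , b ] → suc i ∈[ a , b ]
  maximalRun-stepʳ 1+i≤x eq (a≤i , i≤b) with m≤n⇒m<n∨m≡n i≤b
  ... | inj₁ i<b  = m≤n⇒m≤1+n a≤i , i<b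
  ... | inj₂ refl = ⊥-elim (rightMaximal 1+i≤x eq)

  maximalRun-stepˡ : ∀ {i} → f i ≡ c → suc i ∈[ a , b ] → i ∈[ a , b ]
  maximalRun-stepˡ eq (a≤1+i , 1+i≤b) with m≤n⇒m<n∨m≡n a≤1+i
  ... | inj₁ a<1+i = ≤-pred a<1+i , ≤-trans (n≤1+n _) 1+i≤b
  ... | inj₂ refl  = ⊥-elim (leftMaximal refl eq)

  maximalRun-end-≢ : b < x → f b ≢ f (suc b)
  maximalRun-end-≢ b<x fb≡f[1+b] = rightMaximal b<x (trans (sym fb≡f[1+b]) (constant (a≤b , ≤-refl)))

record Recolouring (x : ℕ) (f g : ℕ → ℕ) (c′ a b : ℕ) : Set where
  field
    inside  : ∀ {j} → j ∈[ a , b ] → g j ≡ c′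
    outside : ∀ {j} → j ≤ x → ¬ j ∈[ a , b ] → g j ≡ f j

module _ {x a b c c′ : ℕ} {f g : ℕ → ℕ}
  (run : MaximalRun x f c a b) (recolouring : Recolouring x f g c′ a b)
  (twoColours : ∀ {i} → i ≤ x → f i ≢ c → f i ≡ c′) where
  open MaximalRun run
  open Recolouring recolouring

  private
    Splits : ℕ → Set
    Splits i = changeAt f i ≡ δ (suc i) a + δ i b + changeAt g i

    tally : ∀ {i p q r} → changeAt f i ≡ p + q + r →
            δ (suc i) a ≡ p → δ i b ≡ q → changeAt g i ≡ r → Splits i
    tally eq refl refl refl = eq

    left-of-run : ∀ {i} → i < x → suc i < a → Splits i
    left-of-run {i} i<x 1+i<a =
      tally (sym (cong₂ differ (outside (<⇒≤ i<x) (<⇒≱ i<a ∘′ proj₁))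
                               (outside i<x (<⇒≱ 1+i<a ∘′ proj₁))))
            (δ-≢ (<⇒≢ 1+i<a)) (δ-≢ (<⇒≢ (<-≤-trans i<a a≤b))) refl
      where i<a = <-trans (n<1+n i) 1+i<a

    run-start : ∀ {i} → i < x → suc i ≡ a → Splits i
    run-start {i} i<x refl =
      tally (differ-≢ λ fi≡f[1+i] → leftMaximal refl (trans fi≡f[1+i] (constant (≤-refl , a≤b))))
            (δ-≡ {suc i} refl) (δ-≢ (<⇒≢ (<-≤-trans (n<1+n i) a≤b)))
            (differ-≡ (trans gi≡c′ (sym (inside (≤-refl , a≤b)))))
      where
      gi≡c′ = trans (outside (<⇒≤ i<x) (λ (1+i≤i , _) → 1+n≰n 1+i≤i))
                    (twoColours (<⇒≤ i<x) (leftMaximal refl))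

    inside-run : ∀ {i} → a ≤ i → i < b → Splits i
    inside-run {i} a≤i i<b =
      tally (differ-≡ (trans (constant i∈) (sym (constant 1+i∈))))
            (δ-≢ (>⇒≢ (s≤s a≤i))) (δ-≢ (<⇒≢ i<b))
            (differ-≡ (trans (inside i∈) (sym (inside 1+i∈))))
      where
      i∈   = a≤i , <⇒≤ i<b
      1+i∈ = m≤n⇒m≤1+n a≤i , i<b

    run-end : ∀ {i} → i < x → a ≤ i → i ≡ b → Splits i
    run-end {i} i<x a≤i refl =
      tally (differ-≢ λ fi≡f[1+i] → rightMaximal i<x (trans (sym fi≡f[1+i]) (constant (a≤i , ≤-refl))))
            (δ-≢ (>⇒≢ (s≤s a≤i))) (δ-≡ {i} refl)
            (differ-≡ (trans (inside (a≤i , ≤-refl)) (sym g[1+i]≡c′)))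
      where
      g[1+i]≡c′ = trans (outside i<x (λ (_ , 1+i≤i) → 1+n≰n 1+i≤i)) (twoColours i<x (rightMaximal i<x))

    right-of-run : ∀ {i} → i < x → b < i → Splits i
    right-of-run {i} i<x b<i =
      tally (sym (cong₂ differ (outside (<⇒≤ i<x) (<⇒≱ b<i ∘′ proj₂))
                               (outside i<x (<⇒≱ (m<n⇒m<1+n b<i) ∘′ proj₂))))
            (δ-≢ (>⇒≢ (s≤s (≤-trans a≤b (<⇒≤ b<i))))) (δ-≢ (>⇒≢ b<i)) refl

    splits : ∀ {i} → i < x → Splits i
    splits {i} i<x with <-cmp (suc i) a
    ... | tri< 1+i<a _ _ = left-of-run i<x 1+i<a
    ... | tri≈ _ 1+i≡a _ = run-start i<x 1+i≡a
    ... | tri> _ _ a<1+i with <-cmp i b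
    ...   | tri< i<b _ _ = inside-run (≤-pred a<1+i) i<b
    ...   | tri≈ _ i≡b _ = run-end i<x (≤-pred a<1+i) i≡b
    ...   | tri> _ _ b<i = right-of-run i<x b<i

  changes-recolour : changes x f ≡ exits x a b + changes x g
  changes-recolour = begin
    changes x f                                                  ≡⟨ sumBelow-cong x splits ⟩
    sumBelow x (λ i → δ (suc i) a + δ i b + changeAt g i)       ≡⟨ sumBelow-+ x _ (changeAt g) ⟩
    sumBelow x (λ i → δ (suc i) a + δ i b) + changes x g        ≡⟨ cong (_+ changes x g) (sumBelow-+ x _ _) ⟩
    exits x a b + changes x g                                    ∎
    where open ≡-Reasoning

-- Flag coloring on a path

module _ {G : Graph} {col : Coloring G} {c : ℕ} where

  sameComp-source : ∀ {v w} → SameComp G col c v w → col v ≡ c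
  sameComp-source (here cv)     = cv
  sameComp-source (step cv _ _) = cv

  sameComp-snoc : ∀ {v w w′} → SameComp G col c v w → Adj G w w′ → col w′ ≡ c →
    SameComp G col c v w′
  sameComp-snoc (here cv)           adj cw′ = step cv adj (here cw′)
  sameComp-snoc (step cv adj₀ rest) adj cw′ = step cv adj₀ (sameComp-snoc rest adj cw′)

module Path (x : ℕ) where

  Vertex : Set
  Vertex = Fin (suc x)

  vertex : ∀ i → .(i ≤ x) → Vertex
  vertex i i≤x = fromℕ< (s≤s i≤x)

  toℕ-vertex : ∀ {i} .(i≤x : i ≤ x) → toℕ (vertex i i≤x) ≡ i
  toℕ-vertex i≤x = toℕ-fromℕ< (s≤s i≤x)

  toℕ≤x : (w : Vertex) → toℕ w ≤ x
  toℕ≤x w = ≤-pred (toℕ<n w)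

  vertex-toℕ : (w : Vertex) → vertex (toℕ w) (toℕ≤x w) ≡ w
  vertex-toℕ w = fromℕ<-toℕ w (s≤s (toℕ≤x w))

  vertex-∈ : ∀ {i a b} .(i≤x : i ≤ x) → i ∈[ a , b ] → toℕ (vertex i i≤x) ∈[ a , b ]
  vertex-∈ {a = a} {b} i≤x = subst (_∈[ a , b ]) (sym (toℕ-vertex i≤x))

  adj-up : ∀ {i} .(i<x : i < x) → Adj (PathGraph x) (vertex i (<⇒≤ i<x)) (vertex (suc i) i<x)
  adj-up i<x = inj₁ (trans (toℕ-vertex i<x) (cong suc (sym (toℕ-vertex (<⇒≤ i<x)))))

  adj-down : ∀ {i} .(i<x : i < x) → Adj (PathGraph x) (vertex (suc i) i<x) (vertex i (<⇒≤ i<x))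
  adj-down i<x = inj₂ (trans (toℕ-vertex i<x) (cong suc (sym (toℕ-vertex (<⇒≤ i<x)))))

  -- The colouring read as a sequence along the path; positions past x get the junk colour 0.
  colours : Coloring (PathGraph x) → ℕ → ℕ
  colours col i with i ≤? x
  ... | yes i≤x = col (vertex i i≤x)
  ... | no  _   = 0

  colours-vertex : ∀ col {i} (i≤x : i ≤ x) → colours col i ≡ col (vertex i i≤x)
  colours-vertex col {i} i≤x with i ≤? x
  ... | yes _   = refl
  ... | no  i≰x = ⊥-elim (i≰x i≤x)

  colours-toℕ : ∀ col (w : Vertex) → colours col (toℕ w) ≡ col w
  colours-toℕ col w = trans (colours-vertex col (toℕ≤x w)) (cong col (vertex-toℕ w))

  Binary : Coloring (PathGraph x) → Set
  Binary col = ∀ w → col w ≤ 1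

  colours-binary : ∀ {col} → Binary col → ∀ i → colours col i ≤ 1
  colours-binary {col} bin i with i ≤? x
  ... | yes i≤x = bin (vertex i i≤x)
  ... | no  _   = z≤n

  module _ {col : Coloring (PathGraph x)} {c a b} (run : MaximalRun x (colours col) c a b) where
    open MaximalRun run

    colour-inRun : ∀ {w : Vertex} → toℕ w ∈[ a , b ] → col w ≡ c
    colour-inRun {w} w∈ = trans (sym (colours-toℕ col w)) (constant w∈)

    adj-inRun : ∀ {u w : Vertex} → Adj (PathGraph x) u w → col w ≡ c →
      toℕ u ∈[ a , b ] → toℕ w ∈[ a , b ]
    adj-inRun {u} {w} (inj₁ w≡1+u) cw u∈ =
      subst (_∈[ a , b ]) (sym w≡1+u)
            (maximalRun-stepʳ run (subst (_≤ x) w≡1+u (toℕ≤x w))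
                              (trans (cong (colours col) (sym w≡1+u)) (trans (colours-toℕ col w) cw)) u∈)
    adj-inRun {u} {w} (inj₂ u≡1+w) cw u∈ =
      maximalRun-stepˡ run (trans (colours-toℕ col w) cw) (subst (_∈[ a , b ]) u≡1+w u∈)

    sameComp⇒inRun : ∀ {v w} → SameComp (PathGraph x) col c v w → toℕ v ∈[ a , b ] → toℕ w ∈[ a , b ]
    sameComp⇒inRun (here _)          v∈ = v∈
    sameComp⇒inRun (step _ adj rest) v∈ = sameComp⇒inRun rest (adj-inRun adj (sameComp-source rest) v∈)

    module _ {v : Vertex} (v∈ : toℕ v ∈[ a , b ]) where
      private
        Reaches : Vertex → Set
        Reaches = SameComp (PathGraph x) col c v

        start : ∀ {j} (j≤x : j ≤ x) → j ≡ toℕ v → Reaches (vertex j j≤x)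
        start j≤x refl = subst Reaches (sym (vertex-toℕ v)) (here (colour-inRun v∈))

        colour-vertex : ∀ {j} (j≤x : j ≤ x) → j ∈[ a , b ] → col (vertex j j≤x) ≡ c
        colour-vertex j≤x j∈ = trans (sym (colours-vertex col j≤x)) (constant j∈)

        reach-up : ∀ k {j} (j≤x : j ≤ x) → j ≡ k + toℕ v → j ≤ b → Reaches (vertex j j≤x)
        reach-up zero    j≤x j≡v  j≤b = start j≤x j≡v
        reach-up (suc k) j≤x refl j≤b =
          sameComp-snoc (reach-up k (<⇒≤ j≤x) refl (<⇒≤ j≤b)) (adj-up j≤x)
                        (colour-vertex j≤x (≤-trans (proj₁ v∈) (m≤n+m (toℕ v) (suc k)) , j≤b))

        reach-down : ∀ k {j} (j≤x : j ≤ x) → k + j ≡ toℕ v → a ≤ j → Reaches (vertex j j≤x)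
        reach-down zero        j≤x j≡v a≤j = start j≤x j≡v
        reach-down (suc k) {j} j≤x eq  a≤j =
          sameComp-snoc (reach-down k 1+j≤x (trans (+-suc k j) eq) (≤-trans a≤j (n≤1+n j)))
                        (adj-down 1+j≤x)
                        (colour-vertex j≤x (a≤j , ≤-trans (n≤1+n j) (≤-trans 1+j≤v (proj₂ v∈))))
          where
          1+j≤v : suc j ≤ toℕ v
          1+j≤v = subst (suc j ≤_) eq (s≤s (m≤n+m j k))
          1+j≤x : suc j ≤ x
          1+j≤x = ≤-trans 1+j≤v (toℕ≤x v)

      inRun⇒sameComp : ∀ {j} (j≤x : j ≤ x) → j ∈[ a , b ] →
        SameComp (PathGraph x) col c v (vertex j j≤x)
      inRun⇒sameComp {j} j≤x (a≤j , j≤b) with ≤-total (toℕ v) j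
      ... | inj₁ v≤j = reach-up (j ∸ toℕ v) j≤x (sym (m∸n+n≡m v≤j)) j≤b
      ... | inj₂ j≤v = reach-down (toℕ v ∸ j) j≤x (m∸n+n≡m j≤v) a≤j

  Recolours : (col col′ : Coloring (PathGraph x)) → Vertex → ℕ → Set
  Recolours col col′ v c′ = ∀ w → (SameComp (PathGraph x) col (col v) v w → col′ w ≡ c′) ×
                                  (¬ SameComp (PathGraph x) col (col v) v w → col′ w ≡ col w)

  recolours⇒recolouring : ∀ {col col′ v c′ a b} → Recolours col col′ v c′ →
    MaximalRun x (colours col) (col v) a b → toℕ v ∈[ a , b ] →
    Recolouring x (colours col) (colours col′) c′ a b
  recolours⇒recolouring {col} {col′} {v} {c′} {a} {b} rec run v∈ =
    record { inside = inside ; outside = outside }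
    where
    inside : ∀ {j} → j ∈[ a , b ] → colours col′ j ≡ c′
    inside {j} j∈ = trans (colours-vertex col′ j≤x)
                          (proj₁ (rec (vertex j j≤x)) (inRun⇒sameComp run v∈ j≤x j∈))
      where j≤x = ≤-trans (proj₂ j∈) (MaximalRun.b≤x run)

    outside : ∀ {j} → j ≤ x → ¬ j ∈[ a , b ] → colours col′ j ≡ colours col j
    outside {j} j≤x j∉ = begin
      colours col′ j  ≡⟨ colours-vertex col′ j≤x ⟩
      col′ w          ≡⟨ proj₂ (rec w) (j∉ ∘′ sameComp⇒inRunᵥ) ⟩
      col w           ≡⟨ sym (colours-vertex col j≤x) ⟩
      colours col j   ∎
      where
      open ≡-Reasoning
      w = vertex j j≤x
      sameComp⇒inRunᵥ : SameComp (PathGraph x) col (col v) v w → j ∈[ a , b ]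
      sameComp⇒inRunᵥ sc = subst (_∈[ a , b ]) (toℕ-vertex j≤x) (sameComp⇒inRun run sc v∈)

  recolourRun : ∀ col {v u : Vertex} {c a b} → Adj (PathGraph x) v u →
    MaximalRun x (colours col) c a b → toℕ v ∈[ a , b ] → col u ≢ c →
    ∃[ col′ ] Move (PathGraph x) col col′ × Recolouring x (colours col) (colours col′) (col u) a b
  recolourRun col {v} {u} {c} {a} {b} adj run v∈ u≢c =
    col′ , (v , col u , (u , adj , refl) , subst (col u ≢_) (sym cv≡c) u≢c , recolours) ,
    recolours⇒recolouring recolours runᵥ v∈
    where
    cv≡c = colour-inRun run v∈
    runᵥ = subst (λ c → MaximalRun x (colours col) c a b) (sym cv≡c) run

    inRun? : ∀ w → Dec (toℕ w ∈[ a , b ])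
    inRun? w = a ≤? toℕ w ×-dec toℕ w ≤? b

    col′ : Coloring (PathGraph x)
    col′ w = if does (inRun? w) then col u else col w

    recolours : Recolours col col′ v (col u)
    recolours w =
      (λ sc  → cong (λ t → if t then col u else col w) (dec-true (inRun? w) (sameComp⇒inRun runᵥ sc v∈))) ,
      (λ ¬sc → cong (λ t → if t then col u else col w) (dec-false (inRun? w) (¬sc ∘′ inRun⇒sameCompᵥ)))
      where
      inRun⇒sameCompᵥ : toℕ w ∈[ a , b ] → SameComp (PathGraph x) col (col v) v w
      inRun⇒sameCompᵥ w∈ =
        subst (SameComp (PathGraph x) col (col v) v) (vertex-toℕ w) (inRun⇒sameComp runᵥ v∈ (toℕ≤x w) w∈)

  changes-recolourRun : ∀ {col col′ c c′ a b} → Binary col →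
    MaximalRun x (colours col) c a b → Recolouring x (colours col) (colours col′) c′ a b →
    c′ ≢ c → c′ ≤ 1 → changes x (colours col) ≡ exits x a b + changes x (colours col′)
  changes-recolourRun {col} {col′} {c} {c′} {a} bin run recolouring c′≢c c′≤1 =
    changes-recolour run recolouring twoColours
    where
    c≤1 = subst (_≤ 1) (MaximalRun.constant run (≤-refl , MaximalRun.a≤b run)) (colours-binary bin a)
    twoColours : ∀ {i} → i ≤ x → colours col i ≢ c → colours col i ≡ c′
    twoColours {i} _ ci≢c =
      trans (≤1-flip (colours-binary bin i) c≤1 ci≢c) (sym (≤1-flip c′≤1 c≤1 c′≢c))

  record RunRecoloured (col col′ : Coloring (PathGraph x)) : Set where
    field
      a b c c′       : ℕ
      run            : MaximalRun x (colours col) c a b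
      recolouring    : Recolouring x (colours col) (colours col′) c′ a b
      c′≢c           : c′ ≢ c
      witness        : Vertex
      witness-colour : col witness ≡ c′

  move⇒runRecoloured : ∀ {col col′} → Move (PathGraph x) col col′ → RunRecoloured col col′
  move⇒runRecoloured {col} (v , c′ , (u , _ , cu≡c′) , c′≢cv , rec)
    with maximalRun (colours col) (toℕ≤x v) (colours-toℕ col v)
  ... | a , b , v∈ , run = record
    { a = a ; b = b ; c = col v ; c′ = c′ ; run = run ; recolouring = recolours⇒recolouring rec run v∈
    ; c′≢c = c′≢cv ; witness = u ; witness-colour = cu≡c′ }

  binary-move : ∀ {col col′} → Binary col → Move (PathGraph x) col col′ → Binary col′
  binary-move {col} {col′} bin mv w = subst (_≤ 1) (colours-toℕ col′ w) (bound (toℕ w) (toℕ≤x w))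
    where
    open RunRecoloured (move⇒runRecoloured mv)
    open Recolouring recolouring
    bound : ∀ j → j ≤ x → colours col′ j ≤ 1
    bound j j≤x with a ≤? j ×-dec j ≤? b
    ... | yes j∈ = subst (_≤ 1) (trans witness-colour (sym (inside j∈))) (bin witness)
    ... | no  j∉ = subst (_≤ 1) (sym (outside j≤x j∉)) (colours-binary bin j)

  changes-move : ∀ {col col′} → Binary col → Move (PathGraph x) col col′ →
    changes x (colours col) ≡ 1 + changes x (colours col′) ⊎
    changes x (colours col) ≡ 2 + changes x (colours col′)
  changes-move {col} {col′} bin mv =
    Sum.map lowered lowered (exits≡1⊎2 (MaximalRun.a≤b run) (MaximalRun.b≤x run) proper)
    where
    open RunRecoloured (move⇒runRecoloured mv)
    proper : ¬ (a ≡ 0 × b ≡ x)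
    proper (a≡0 , b≡x) = c′≢c (trans (sym witness-colour) (colour-inRun run witness∈))
      where
      witness∈ : toℕ witness ∈[ a , b ]
      witness∈ = subst (_≤ toℕ witness) (sym a≡0) z≤n ,
                 subst (toℕ witness ≤_) (sym b≡x) (toℕ≤x witness)
    lowered : ∀ {k} → exits x a b ≡ k → changes x (colours col) ≡ k + changes x (colours col′)
    lowered ex =
      trans (changes-recolourRun bin run recolouring c′≢c (subst (_≤ 1) witness-colour (bin witness)))
            (cong (_+ changes x (colours col′)) ex)

  recolourRun-lowers : ∀ {col v u c a b k m} → Binary col → Adj (PathGraph x) v u →
    MaximalRun x (colours col) c a b → toℕ v ∈[ a , b ] → col u ≢ c →
    exits x a b ≡ k → changes x (colours col) ≡ k + m →
    ∃[ col′ ] Move (PathGraph x) col col′ × changes x (colours col′) ≡ m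
  recolourRun-lowers {col} {u = u} {k = k} bin adj run v∈ u≢c ex eq with recolourRun col adj run v∈ u≢c
  ... | col′ , mv , recolouring = col′ , mv , +-cancelˡ-≡ k _ _ (trans (sym count) eq)
    where
    count : changes x (colours col) ≡ k + changes x (colours col′)
    count = trans (changes-recolourRun bin run recolouring u≢c (bin u))
                  (cong (_+ changes x (colours col′)) ex)

  firstRun : ∀ col → 0 < changes x (colours col) →
    ∃[ b ] b < x × MaximalRun x (colours col) (colours col 0) 0 b
  firstRun col changed with maximalRun (colours col) {v = 0} z≤n refl
  ... | _ , b , (z≤n , _) , run with m≤n⇒m<n∨m≡n (MaximalRun.b≤x run)
  ...   | inj₁ b<x  = b , b<x , run
  ...   | inj₂ refl =
    ⊥-elim (<-irrefl (sym (changes-constant (λ j≤b → MaximalRun.constant run (z≤n , j≤b)))) changed)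

  lower-by-1 : ∀ {col m} → Binary col → changes x (colours col) ≡ 1 + m →
    ∃[ col′ ] Move (PathGraph x) col col′ × changes x (colours col′) ≡ m
  lower-by-1 {col} bin eq with firstRun col (subst (0 <_) (sym eq) (s≤s z≤n))
  ... | b , b<x , first =
    recolourRun-lowers bin (adj-up b<x) first (vertex-∈ (<⇒≤ b<x) (z≤n , ≤-refl))
                       (MaximalRun.rightMaximal first b<x ∘′ trans (colours-vertex col b<x))
                       (exits-initial b<x) eq

  lower-by-2 : ∀ {col m} → Binary col → changes x (colours col) ≡ 2 + m →
    ∃[ col′ ] Move (PathGraph x) col col′ × changes x (colours col′) ≡ m
  lower-by-2 {col} bin eq with firstRun col (subst (0 <_) (sym eq) (s≤s z≤n))
  ... | b₀ , b₀<x , first with maximalRun (colours col) {v = suc b₀} b₀<x refl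
  ... | zero , b , (_ , 1+b₀≤b) , second =
    ⊥-elim (maximalRun-end-≢ first b₀<x (MaximalRun.constant second (z≤n , <⇒≤ 1+b₀≤b)))
  ... | suc a , b , (a<1+b₀ , 1+b₀≤b) , second with m≤n⇒m<n∨m≡n (MaximalRun.b≤x second)
  ...   | inj₁ b<x  =
    recolourRun-lowers bin (adj-down b₀<x) second (vertex-∈ b₀<x (a<1+b₀ , 1+b₀≤b))
                       (maximalRun-end-≢ first b₀<x ∘′ trans (colours-vertex col (<⇒≤ b₀<x)))
                       (exits-inner (MaximalRun.a≤b second) b<x) eq
  ...   | inj₂ refl = ⊥-elim (0≢1+n (suc-injective (trans (sym twoRuns) eq)))
    where
    twoRuns : changes x (colours col) ≡ 1
    twoRuns = changes-twoRuns (MaximalRun.constant first) (MaximalRun.constant second) a<1+b₀ b₀<x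
                              (≢-sym (MaximalRun.rightMaximal first b₀<x))

  properTwoColoring-binary : Binary (properTwoColoring x)
  properTwoColoring-binary w = ≤-pred (m%n<n (toℕ w) 2)

  changes-properTwoColoring : changes x (colours (properTwoColoring x)) ≡ x
  changes-properTwoColoring = changes-alternating λ {i} i<x →
    subst₂ _≢_ (sym (parity (<⇒≤ i<x))) (sym (parity i<x)) (n%2≢[1+n]%2 i)
    where
    parity : ∀ {i} (i≤x : i ≤ x) → colours (properTwoColoring x) i ≡ i % 2
    parity i≤x = trans (colours-vertex (properTwoColoring x) i≤x) (cong (_% 2) (toℕ-vertex i≤x))

open Path

theorem3 : (x : ℕ) → IsGrundy (PathGraph x) (properTwoColoring x) (x % 3)
theorem3 x =
  subst (λ n → IsGrundy (PathGraph x) (properTwoColoring x) (n % 3)) (changes-properTwoColoring x)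
        (isGrundy-%3 (Binary x) (changes x ∘′ colours x) (binary-move x) (changes-move x)
                     (lower-by-1 x) (lower-by-2 x) (properTwoColoring x) (properTwoColoring-binary x))
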